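{- Let $G$ and $H$ be nontrivial, connected graphs both having girth at least $4$. If $G$ has minimum degree $1$ and order at least $3$, then $G \Box H$ is not well-covered.
   Context: All graphs are finite and simple; "nontrivial" means having at least two vertices. A graph is well-covered if all its maximal independent sets have the same cardinality. The girth of a graph is the length of its shortest cycle ($\infty$ for forests). The Cartesian product $G \Box H$ has vertex set $V(G)\times V(H)$, with $(g_1,h_1)$ adjacent to $(g_2,h_2)$ if either $g_1=g_2$ and $h_1h_2\in E(H)$, or $h_1=h_2$ and $g_1g_2\in E(G)$. -}

module Defs where

open import Data.Nat using (ℕ; _*_; _≤_)
open import Data.Bool using (Bool; true; false; T; _∧_; _∨_)
open import Data.Fin using (Fin; _≟_; combine; remQuot)
open import Data.Fin.Subset using (Subset; _∈_; _∉_; _⊆_; ∣_∣)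
open import Data.Vec using (tabulate)
open import Data.Product using (Σ; _×_; _,_; ∃)
open import Relation.Nullary using (¬_)
open import Relation.Nullary.Decidable using (⌊_⌋)
open import Relation.Binary.PropositionalEquality using (_≡_)

record Graph : Set where
  field
    n     : ℕ
    adj   : Fin n → Fin n → Bool
    sym   : ∀ u v → adj u v ≡ adj v u
    irrefl : ∀ v → adj v v ≡ false
open Graph public

Adj : (G : Graph) → Fin (n G) → Fin (n G) → Set
Adj G u v = T (adj G u v)

Nontrivial : Graph → Set
Nontrivial G = 2 ≤ n G

data Reach (G : Graph) : Fin (n G) → Fin (n G) → Set where
  here : ∀ {u} → Reach G u u
  step : ∀ {u v w} → Adj G u v → Reach G v w → Reach G u w

Connected : Graph → Set
Connected G = ∀ u v → Reach G u v

-- girth at least 4: there is no cycle of length 3 (cycles in a simple graph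
-- have length ≥ 3, so this says exactly that no cycle is shorter than 4)
GirthAtLeast4 : Graph → Set
GirthAtLeast4 G = ∀ u v w → ¬ (Adj G u v × Adj G v w × Adj G w u)

degree : (G : Graph) → Fin (n G) → ℕ
degree G v = ∣ tabulate (adj G v) ∣

MinDegree : Graph → ℕ → Set
MinDegree G k = (∀ v → k ≤ degree G v) × ∃ λ v → degree G v ≡ k

Independent : {m : ℕ} → (Fin m → Fin m → Bool) → Subset m → Set
Independent a S = ∀ u v → u ∈ S → v ∈ S → ¬ T (a u v)

MaximalIndependent : {m : ℕ} → (Fin m → Fin m → Bool) → Subset m → Set
MaximalIndependent a S =
  Independent a S × (∀ S′ → Independent a S′ → S ⊆ S′ → S′ ⊆ S)

WellCoveredAdj : {m : ℕ} → (Fin m → Fin m → Bool) → Set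
WellCoveredAdj a = ∀ S S′ → MaximalIndependent a S → MaximalIndependent a S′ → ∣ S ∣ ≡ ∣ S′ ∣

-- Cartesian product G □ H on Fin (n G * n H); the vertex combine g h ↦ (g , h)
□adj : (G H : Graph) → Fin (n G * n H) → Fin (n G * n H) → Bool
□adj G H x y with remQuot (n H) x | remQuot (n H) y
... | g₁ , h₁ | g₂ , h₂ =
  (⌊ g₁ ≟ g₂ ⌋ ∧ adj H h₁ h₂) ∨ (⌊ h₁ ≟ h₂ ⌋ ∧ adj G g₁ g₂)

WellCovered□ : Graph → Graph → Set
WellCovered□ G H = WellCoveredAdj (□adj G H)

-- Let x be a leaf of G with neighbour y, let z ≠ x be a second neighbour of y, and let ab be
-- an edge of H.  As G and H are triangle-free, the vertex (x,b) together with
-- (N(y) ∖ {x}) × {a},  {z} × (N(b) ∖ {a})  and  {y} × (N(a) ∖ {b})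
-- is independent in G □ H, and it dominates every neighbour of (x,a) and of (y,b) other
-- than (x,b).  So a maximal independent set M containing it meets the neighbourhoods of
-- (x,a) and (y,b) only in (x,b); exchanging (x,b) for the non-adjacent pair (x,a), (y,b)
-- yields an independent set larger than M, which extends to a larger maximal one.
module Submission where

open import Defs hiding (sym)
open import Data.Bool using (Bool; true; false; T; _∧_)
open import Data.Bool.Properties using (T-≡; T-∨)
open import Data.Fin using (Fin; zero; suc; _≟_; combine; remQuot; punchIn; punchOut)
open import Data.Fin.Properties
  using (all?; remQuot-combine; combine-remQuot; punchInᵢ≢i; punchIn-injective; punchIn-punchOut)
open import Data.Fin.Subset using (Subset; inside; outside; _∈_; _∉_; _⊆_; ∣_∣; _∪_; ⁅_⁆; _-_)
open import Data.Fin.Subset.Properties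
  using (_∈?_; p⊆p∪q; x∈p∪q⁻; x∈p∪q⁺; x∈⁅x⁆; x∈⁅y⁆⇒x≡y; p⊆q⇒∣p∣≤∣q∣; p⊂q⇒∣p∣<∣q∣; p─⊥≡p; x∈p∧x≢y⇒x∈p-y; p─q⊆p;
         nonempty?; Empty-unique; ∣⊥∣≡0)
open import Data.List using (List; []; _∷_; allFin)
open import Data.List.Membership.Propositional using () renaming (_∈_ to _∈ₗ_)
open import Data.List.Membership.Propositional.Properties using (∈-allFin)
open import Data.List.Relation.Unary.Any using (here; there)
open import Data.Nat using (ℕ; suc; _*_; _≤_; _<_; s≤s)
open import Data.Nat.Properties using (<-≤-trans; <-irrefl; module ≤-Reasoning)
open import Data.Product using (_×_; _,_; ∃₂; ∃-syntax; proj₁; proj₂)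
open import Data.Sum using (_⊎_; inj₁; inj₂; [_,_]′) renaming (map to ⊎-map)
open import Data.Vec using (tabulate; _∷_; here; there)
open import Data.Vec.Properties using ([]=⇒lookup; lookup⇒[]=; lookup∘tabulate)
open import Function using (id; _∘_; _⇔_; mk⇔; Equivalence)
open import Relation.Unary using (Pred; Decidable)
open import Relation.Nullary using (¬_; Dec; yes; no; contradiction)
open import Relation.Nullary.Decidable
  using (⌊_⌋; toWitness; fromWitness; map′; _×-dec_; _⊎-dec_; _→-dec_; ¬?)
open import Relation.Nullary.Decidable.Core using (T?)
open import Relation.Binary.PropositionalEquality using (_≡_; _≢_; refl; sym; trans; cong; subst; subst₂)

T-⇔⇒≡ : ∀ {x y} → (T x → T y) → (T y → T x) → x ≡ y
T-⇔⇒≡ {false} {false} _ _ = refl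
T-⇔⇒≡ {false} {true}  _ y⇒x = contradiction _ y⇒x
T-⇔⇒≡ {true}  {false} x⇒y _ = contradiction _ x⇒y
T-⇔⇒≡ {true}  {true}  _ _ = refl

T-⌊⌋∧ : ∀ {A : Set} (a? : Dec A) {b} → T (⌊ a? ⌋ ∧ b) ⇔ (A × T b)
T-⌊⌋∧ (yes a) = mk⇔ (a ,_) proj₂
T-⌊⌋∧ (no ¬a) = mk⇔ (λ ()) (¬a ∘ proj₁)

∈-tabulate : ∀ {m} {f : Fin m → Bool} {i} → i ∈ tabulate f ⇔ T (f i)
∈-tabulate {f = f} {i} = mk⇔
  (λ i∈ → Equivalence.from T-≡ (trans (sym (lookup∘tabulate f i)) ([]=⇒lookup i∈)))
  (λ t → lookup⇒[]= i (tabulate f) (trans (lookup∘tabulate f i) (Equivalence.to T-≡ t)))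

∣p∣≡1+∣p-x∣ : ∀ {m} {p : Subset m} {x} → x ∈ p → ∣ p ∣ ≡ suc ∣ p - x ∣
∣p∣≡1+∣p-x∣ {p = inside ∷ p} here = cong suc (cong ∣_∣ (sym (p─⊥≡p p)))
∣p∣≡1+∣p-x∣ {p = inside ∷ p} (there x∈p) = cong suc (∣p∣≡1+∣p-x∣ x∈p)
∣p∣≡1+∣p-x∣ {p = outside ∷ p} (there x∈p) = ∣p∣≡1+∣p-x∣ x∈p

x∈p-y⇒x≢y : ∀ {m} {p : Subset m} {x y} → x ∈ p - y → x ≢ y
x∈p-y⇒x≢y {p = _ ∷ _} {zero} {zero} ()
x∈p-y⇒x≢y {x = zero} {suc _} _ ()
x∈p-y⇒x≢y {x = suc _} {zero} _ ()
x∈p-y⇒x≢y {p = _ ∷ _} {suc _} {suc _} (there x∈p-y) refl = x∈p-y⇒x≢y x∈p-y refl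

∣p∣≡1⇒singleton : ∀ {m} {p : Subset m} → ∣ p ∣ ≡ 1 → ∃[ y ] y ∈ p × (∀ {x} → x ∈ p → x ≡ y)
∣p∣≡1⇒singleton {m} {p} ∣p∣≡1 with nonempty? p
... | no ∅ = contradiction (trans (sym ∣p∣≡1) (trans (cong ∣_∣ (Empty-unique ∅)) (∣⊥∣≡0 m))) λ ()
... | yes (y , y∈p) = y , y∈p , unique
  where
  unique : ∀ {x} → x ∈ p → x ≡ y
  unique {x} x∈p with x ≟ y
  ... | yes x≡y = x≡y
  ... | no x≢y = contradiction
    (trans (sym ∣p∣≡1) (trans (∣p∣≡1+∣p-x∣ y∈p) (cong suc (∣p∣≡1+∣p-x∣ (x∈p∧x≢y⇒x∈p-y x∈p x≢y))))) λ ()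

x∉p⇒∣p∣<∣p∪⁅x⁆∣ : ∀ {m} {p : Subset m} {x} → x ∉ p → ∣ p ∣ < ∣ p ∪ ⁅ x ⁆ ∣
x∉p⇒∣p∣<∣p∪⁅x⁆∣ {p = p} {x} x∉p =
  p⊂q⇒∣p∣<∣q∣ (p⊆p∪q ⁅ x ⁆ , x , x∈p∪q⁺ (inj₂ (x∈⁅x⁆ x)) , x∉p)

module _ {m : ℕ} (a : Fin m → Fin m → Bool) where

  independent? : (S : Subset m) → Dec (Independent a S)
  independent? S = all? λ u → all? λ v → u ∈? S →-dec v ∈? S →-dec ¬? (T? (a u v))

  Independent-⊆ : ∀ {S S′} → S ⊆ S′ → Independent a S′ → Independent a S
  Independent-⊆ S⊆S′ indS′ u v u∈S v∈S = indS′ u v (S⊆S′ u∈S) (S⊆S′ v∈S)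

  greedy : Subset m → List (Fin m) → Subset m
  greedy S [] = S
  greedy S (i ∷ is) with independent? (S ∪ ⁅ i ⁆)
  ... | yes _ = greedy (S ∪ ⁅ i ⁆) is
  ... | no  _ = greedy S is

  ⊆-greedy : ∀ S is → S ⊆ greedy S is
  ⊆-greedy S [] = id
  ⊆-greedy S (i ∷ is) with independent? (S ∪ ⁅ i ⁆)
  ... | yes _ = ⊆-greedy (S ∪ ⁅ i ⁆) is ∘ p⊆p∪q ⁅ i ⁆
  ... | no  _ = ⊆-greedy S is

  greedy-independent : ∀ S is → Independent a S → Independent a (greedy S is)
  greedy-independent S [] indS = indS
  greedy-independent S (i ∷ is) indS with independent? (S ∪ ⁅ i ⁆)
  ... | yes indS∪i = greedy-independent (S ∪ ⁅ i ⁆) is indS∪i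
  ... | no  _      = greedy-independent S is indS

  -- A rejected vertex already broke independence of a subset of S′.
  greedy-saturated : ∀ S is {i} → i ∈ₗ is → ∀ S′ → Independent a S′ →
                     greedy S is ⊆ S′ → i ∈ S′ → i ∈ greedy S is
  greedy-saturated S (i ∷ is) (here refl) S′ indS′ ⊆S′ i∈S′ with independent? (S ∪ ⁅ i ⁆)
  ... | yes _ = ⊆-greedy (S ∪ ⁅ i ⁆) is (x∈p∪q⁺ (inj₂ (x∈⁅x⁆ i)))
  ... | no ¬ind = contradiction (Independent-⊆ S∪i⊆S′ indS′) ¬ind
    where
    S∪i⊆S′ : S ∪ ⁅ i ⁆ ⊆ S′
    S∪i⊆S′ k∈ with x∈p∪q⁻ S ⁅ i ⁆ k∈
    ... | inj₁ k∈S = ⊆S′ (⊆-greedy S is k∈S)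
    ... | inj₂ k∈i rewrite x∈⁅y⁆⇒x≡y i k∈i = i∈S′
  greedy-saturated S (j ∷ is) (there i∈is) S′ indS′ ⊆S′ i∈S′ with independent? (S ∪ ⁅ j ⁆)
  ... | yes _ = greedy-saturated (S ∪ ⁅ j ⁆) is i∈is S′ indS′ ⊆S′ i∈S′
  ... | no  _ = greedy-saturated S is i∈is S′ indS′ ⊆S′ i∈S′

  ⊆-maximalIndependent : ∀ {S} → Independent a S → ∃[ M ] S ⊆ M × MaximalIndependent a M
  ⊆-maximalIndependent {S} indS =
    greedy S (allFin m) ,
    ⊆-greedy S (allFin m) ,
    greedy-independent S (allFin m) indS ,
    λ S′ indS′ ⊆S′ {i} i∈S′ → greedy-saturated S (allFin m) (∈-allFin i) S′ indS′ ⊆S′ i∈S′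

  larger-independent⇒¬wellCovered : ∀ {M S} → MaximalIndependent a M → Independent a S →
                                    ∣ M ∣ < ∣ S ∣ → ¬ WellCoveredAdj a
  larger-independent⇒¬wellCovered {M} {S} maxM indS ∣M∣<∣S∣ wc
    with ⊆-maximalIndependent indS
  ... | M′ , S⊆M′ , maxM′ =
    <-irrefl (wc M M′ maxM maxM′) (<-≤-trans ∣M∣<∣S∣ (p⊆q⇒∣p∣≤∣q∣ S⊆M′))

∃-distinct : ∀ {m} → 2 ≤ m → ∃₂ λ (i j : Fin m) → i ≢ j
∃-distinct (s≤s (s≤s _)) = zero , suc zero , λ ()

∃-avoiding : ∀ {m} → 3 ≤ m → (x y : Fin m) → ∃[ t ] t ≢ x × t ≢ y
∃-avoiding (s≤s (s≤s (s≤s _))) x y with x ≟ y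
... | yes refl = punchIn x zero , punchInᵢ≢i x zero , punchInᵢ≢i x zero
... | no x≢y = punchIn x t′ , punchInᵢ≢i x t′ , t≢y
  where
  t′ = punchIn (punchOut x≢y) zero
  t≢y : punchIn x t′ ≢ y
  t≢y t≡y = punchInᵢ≢i (punchOut x≢y) zero
    (punchIn-injective x _ _ (trans t≡y (sym (punchIn-punchOut x≢y))))

module _ (Γ : Graph) where

  Adj-sym : ∀ {u v} → Adj Γ u v → Adj Γ v u
  Adj-sym {u} {v} = subst T (Graph.sym Γ u v)

  Adj-irrefl : ∀ {v} → ¬ Adj Γ v v
  Adj-irrefl {v} = subst T (irrefl Γ v)

  walk-crosses : ∀ {ℓ} {P : Pred (Fin (n Γ)) ℓ} → Decidable P → ∀ {u t} → Reach Γ u t →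
                 P u → ¬ P t → ∃₂ λ s s′ → P s × ¬ P s′ × Adj Γ s s′
  walk-crosses P? here Pu ¬Pt = contradiction Pu ¬Pt
  walk-crosses P? (step {v = v} u∼v walk) Pu ¬Pt with P? v
  ... | yes Pv = walk-crosses P? walk Pv ¬Pt
  ... | no ¬Pv = _ , v , Pu , ¬Pv , u∼v

  nontrivial-connected⇒edge : Nontrivial Γ → Connected Γ → ∃₂ λ a b → Adj Γ a b
  nontrivial-connected⇒edge nontrivial connected with ∃-distinct nontrivial
  ... | i , j , i≢j with walk-crosses (_≟ i) (connected i j) refl (i≢j ∘ sym)
  ... | a , b , _ , _ , a∼b = a , b , a∼b

  degree≡1⇒unique-neighbour : ∀ {x} → degree Γ x ≡ 1 →
                              ∃[ y ] Adj Γ x y × (∀ {g} → Adj Γ x g → g ≡ y)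
  degree≡1⇒unique-neighbour deg≡1 with ∣p∣≡1⇒singleton deg≡1
  ... | y , y∈N , unique =
    y , Equivalence.to ∈-tabulate y∈N , unique ∘ Equivalence.from ∈-tabulate

  leaf-neighbour-has-other-neighbour : Connected Γ → 3 ≤ n Γ → ∀ {x y} →
    (∀ {g} → Adj Γ x g → g ≡ y) → ∃[ z ] Adj Γ y z × z ≢ x
  leaf-neighbour-has-other-neighbour connected 3≤n {x} {y} leaf
    with ∃-avoiding 3≤n x y
  ... | t , t≢x , t≢y
    with walk-crosses (λ s → s ≟ x ⊎-dec s ≟ y) (connected x t) (inj₁ refl) [ t≢x , t≢y ]′
  ... | _ , s′ , inj₁ refl , s′∉xy , x∼s′ = contradiction (inj₂ (leaf x∼s′)) s′∉xy
  ... | _ , z , inj₂ refl , z∉xy , y∼z = z , y∼z , z∉xy ∘ inj₁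

  girth≥4⇒neighbours-nonadjacent : GirthAtLeast4 Γ → ∀ {c g g′} →
                                    Adj Γ c g → Adj Γ c g′ → ¬ Adj Γ g g′
  girth≥4⇒neighbours-nonadjacent girth c∼g c∼g′ g∼g′ = girth _ _ _ (c∼g , g∼g′ , Adj-sym c∼g′)

  Dominated : Subset (n Γ) → Fin (n Γ) → Set
  Dominated I k = ∃[ t ] t ∈ I × Adj Γ k t

  Independent-∪⁅⁆ : ∀ {S i} → Independent (adj Γ) S → (∀ {k} → k ∈ S → ¬ Adj Γ i k) →
                    Independent (adj Γ) (S ∪ ⁅ i ⁆)
  Independent-∪⁅⁆ {S} {i} indS i≁S u v u∈ v∈ with x∈p∪q⁻ S ⁅ i ⁆ u∈ | x∈p∪q⁻ S ⁅ i ⁆ v∈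
  ... | inj₁ u∈S | inj₁ v∈S = indS u v u∈S v∈S
  ... | inj₁ u∈S | inj₂ v∈i rewrite x∈⁅y⁆⇒x≡y i v∈i = i≁S u∈S ∘ Adj-sym
  ... | inj₂ u∈i | inj₁ v∈S rewrite x∈⁅y⁆⇒x≡y i u∈i = i≁S v∈S
  ... | inj₂ u∈i | inj₂ v∈i rewrite x∈⁅y⁆⇒x≡y i u∈i | x∈⁅y⁆⇒x≡y i v∈i = Adj-irrefl

  -- Extend I to a maximal independent set M; then (M - u) ∪ {v, w} is independent
  -- and one larger than M.
  exchange⇒¬wellCovered : ∀ {I u v w} → Independent (adj Γ) I → u ∈ I →
    Adj Γ u v → Adj Γ u w → v ≢ w → ¬ Adj Γ v w →
    (∀ {k} → Adj Γ v k → k ≢ u → Dominated I k) →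
    (∀ {k} → Adj Γ w k → k ≢ u → Dominated I k) →
    ¬ WellCoveredAdj (adj Γ)
  exchange⇒¬wellCovered {I} {u} {v} {w} indI u∈I u∼v u∼w v≢w v≁w domv domw
    with ⊆-maximalIndependent (adj Γ) indI
  ... | M , I⊆M , maxM@(indM , _) =
    larger-independent⇒¬wellCovered (adj Γ) maxM indS ∣M∣<∣S∣
    where
    Sv = (M - u) ∪ ⁅ v ⁆
    S  = Sv ∪ ⁅ w ⁆

    dominated∉M : ∀ {k} → Dominated I k → k ∉ M
    dominated∉M (t , t∈I , k∼t) k∈M = indM _ t k∈M (I⊆M t∈I) k∼t

    nbr∉M : ∀ {k} → Adj Γ u k → k ∉ M
    nbr∉M u∼k k∈M = indM u _ (I⊆M u∈I) k∈M u∼k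

    M-u⊆M : M - u ⊆ M
    M-u⊆M = p─q⊆p M ⁅ u ⁆

    v≁M-u : ∀ {k} → k ∈ M - u → ¬ Adj Γ v k
    v≁M-u k∈ v∼k = dominated∉M (domv v∼k (x∈p-y⇒x≢y k∈)) (M-u⊆M k∈)

    w≁Sv : ∀ {k} → k ∈ Sv → ¬ Adj Γ w k
    w≁Sv {k} k∈ w∼k with x∈p∪q⁻ (M - u) ⁅ v ⁆ k∈
    ... | inj₁ k∈M-u = dominated∉M (domw w∼k (x∈p-y⇒x≢y k∈M-u)) (M-u⊆M k∈M-u)
    ... | inj₂ k∈v rewrite x∈⁅y⁆⇒x≡y v k∈v = v≁w (Adj-sym w∼k)

    indS : Independent (adj Γ) S
    indS = Independent-∪⁅⁆ (Independent-∪⁅⁆ (Independent-⊆ (adj Γ) M-u⊆M indM) v≁M-u) w≁Sv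

    w∉Sv : w ∉ Sv
    w∉Sv w∈ with x∈p∪q⁻ (M - u) ⁅ v ⁆ w∈
    ... | inj₁ w∈M-u = nbr∉M u∼w (M-u⊆M w∈M-u)
    ... | inj₂ w∈v = v≢w (sym (x∈⁅y⁆⇒x≡y v w∈v))

    ∣M∣<∣S∣ : ∣ M ∣ < ∣ S ∣
    ∣M∣<∣S∣ = begin-strict
      ∣ M ∣          ≡⟨ ∣p∣≡1+∣p-x∣ (I⊆M u∈I) ⟩
      suc ∣ M - u ∣  ≤⟨ x∉p⇒∣p∣<∣p∪⁅x⁆∣ (nbr∉M u∼v ∘ M-u⊆M) ⟩
      ∣ Sv ∣         <⟨ x∉p⇒∣p∣<∣p∪⁅x⁆∣ w∉Sv ⟩
      ∣ S ∣          ∎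
      where open ≤-Reasoning

module Product (G H : Graph) where

  Vertex : Set
  Vertex = Fin (n G) × Fin (n H)

  infix 4 _∼_
  _∼_ : Vertex → Vertex → Set
  (g , h) ∼ (g′ , h′) = g ≡ g′ × Adj H h h′ ⊎ h ≡ h′ × Adj G g g′

  ∼-sym : ∀ {p q} → p ∼ q → q ∼ p
  ∼-sym (inj₁ (refl , h∼h′)) = inj₁ (refl , Adj-sym H h∼h′)
  ∼-sym (inj₂ (refl , g∼g′)) = inj₂ (refl , Adj-sym G g∼g′)

  ∼-irrefl : ∀ {p} → ¬ p ∼ p
  ∼-irrefl (inj₁ (_ , h∼h)) = Adj-irrefl H h∼h
  ∼-irrefl (inj₂ (_ , g∼g)) = Adj-irrefl G g∼g

  coords : Fin (n G * n H) → Vertex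
  coords = remQuot {n G} (n H)

  -- □adj matches on the pair remQuot k, so by η it unfolds to a formula in the projections.
  □adj⇔∼ : ∀ k l → T (□adj G H k l) ⇔ coords k ∼ coords l
  □adj⇔∼ k l = mk⇔
    (⊎-map (Equivalence.to (T-⌊⌋∧ (g₁ ≟ g₂))) (Equivalence.to (T-⌊⌋∧ (h₁ ≟ h₂))) ∘ Equivalence.to T-∨)
    (Equivalence.from T-∨ ∘ ⊎-map (Equivalence.from (T-⌊⌋∧ (g₁ ≟ g₂))) (Equivalence.from (T-⌊⌋∧ (h₁ ≟ h₂))))
    where
    g₁ = proj₁ (coords k)
    h₁ = proj₂ (coords k)
    g₂ = proj₁ (coords l)
    h₂ = proj₂ (coords l)

  □adj-sym : ∀ k l → □adj G H k l ≡ □adj G H l k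
  □adj-sym k l = T-⇔⇒≡ (flipped k l) (flipped l k)
    where
    flipped : ∀ k l → T (□adj G H k l) → T (□adj G H l k)
    flipped k l = Equivalence.from (□adj⇔∼ l k) ∘ ∼-sym ∘ Equivalence.to (□adj⇔∼ k l)

  □adj-irrefl : ∀ k → □adj G H k k ≡ false
  □adj-irrefl k = T-⇔⇒≡ (∼-irrefl ∘ Equivalence.to (□adj⇔∼ k k)) λ ()

_□_ : Graph → Graph → Graph
G □ H = record
  { n      = n G * n H
  ; adj    = □adj G H
  ; sym    = Product.□adj-sym G H
  ; irrefl = Product.□adj-irrefl G H
  }

module _ {G H : Graph} where
  open Product G H

  ⟨_⟩ : Vertex → Fin (n G * n H)
  ⟨ g , h ⟩ = combine g h

  coords-⟨⟩ : ∀ p → coords ⟨ p ⟩ ≡ p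
  coords-⟨⟩ (g , h) = remQuot-combine g h

  ⟨⟩-coords : ∀ k → ⟨ coords k ⟩ ≡ k
  ⟨⟩-coords = combine-remQuot {n G} (n H)

  ⟨⟩-injective : ∀ {p q} → ⟨ p ⟩ ≡ ⟨ q ⟩ → p ≡ q
  ⟨⟩-injective {p} {q} eq = trans (sym (coords-⟨⟩ p)) (trans (cong coords eq) (coords-⟨⟩ q))

  Adj⇒∼ : ∀ {k l} → Adj (G □ H) k l → coords k ∼ coords l
  Adj⇒∼ {k} {l} = Equivalence.to (□adj⇔∼ k l)

  ∼⇒Adj : ∀ {k l} → coords k ∼ coords l → Adj (G □ H) k l
  ∼⇒Adj {k} {l} = Equivalence.from (□adj⇔∼ k l)

  Adj-⟨⟩⇒∼ : ∀ {p q} → Adj (G □ H) ⟨ p ⟩ ⟨ q ⟩ → p ∼ q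
  Adj-⟨⟩⇒∼ {p} {q} = subst₂ _∼_ (coords-⟨⟩ p) (coords-⟨⟩ q) ∘ Adj⇒∼

  ∼⇒Adj-⟨⟩ : ∀ {p q} → p ∼ q → Adj (G □ H) ⟨ p ⟩ ⟨ q ⟩
  ∼⇒Adj-⟨⟩ {p} {q} = ∼⇒Adj ∘ subst₂ _∼_ (sym (coords-⟨⟩ p)) (sym (coords-⟨⟩ q))

  vertices : ∀ {ℓ} {P : Pred Vertex ℓ} → Decidable P → Subset (n G * n H)
  vertices P? = tabulate (λ k → ⌊ P? (coords k) ⌋)

  ∈-vertices : ∀ {ℓ} {P : Pred Vertex ℓ} (P? : Decidable P) {k} → k ∈ vertices P? ⇔ P (coords k)
  ∈-vertices P? = mk⇔ (toWitness ∘ Equivalence.to ∈-tabulate) (Equivalence.from ∈-tabulate ∘ fromWitness)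

  exchange⇒¬wellCovered□ : ∀ {ℓ} {P : Pred Vertex ℓ} → Decidable P →
    (∀ {p q} → P p → P q → ¬ p ∼ q) →
    ∀ {u v w} → P u → u ∼ v → u ∼ w → v ≢ w → ¬ v ∼ w →
    (∀ {q} → v ∼ q → q ≢ u → ∃[ s ] P s × q ∼ s) →
    (∀ {q} → w ∼ q → q ≢ u → ∃[ s ] P s × q ∼ s) →
    ¬ WellCovered□ G H
  exchange⇒¬wellCovered□ {P = P} P? indP {u} {v} {w} Pu u∼v u∼w v≢w v≁w domv domw =
    exchange⇒¬wellCovered (G □ H) indI
      (Equivalence.from (∈-vertices P?) (subst P (sym (coords-⟨⟩ u)) Pu))
      (∼⇒Adj-⟨⟩ u∼v) (∼⇒Adj-⟨⟩ u∼w) (v≢w ∘ ⟨⟩-injective) (v≁w ∘ Adj-⟨⟩⇒∼)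
      (dominated domv) (dominated domw)
    where
    indI : Independent (□adj G H) (vertices P?)
    indI k l k∈ l∈ = indP (Equivalence.to (∈-vertices P?) k∈) (Equivalence.to (∈-vertices P?) l∈) ∘ Adj⇒∼

    dominated : ∀ {r} → (∀ {q} → r ∼ q → q ≢ u → ∃[ s ] P s × q ∼ s) →
                ∀ {k} → Adj (G □ H) ⟨ r ⟩ k → k ≢ ⟨ u ⟩ → Dominated (G □ H) (vertices P?) k
    dominated {r} dom {k} r∼k k≢u
      with dom (subst (_∼ coords k) (coords-⟨⟩ r) (Adj⇒∼ r∼k))
               (λ eq → k≢u (trans (sym (⟨⟩-coords k)) (cong ⟨_⟩ eq)))
    ... | s , Ps , k∼s =
      ⟨ s ⟩ ,
      Equivalence.from (∈-vertices P?) (subst P (sym (coords-⟨⟩ s)) Ps) ,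
      ∼⇒Adj (subst (coords k ∼_) (sym (coords-⟨⟩ s)) k∼s)

module LeafConfiguration
  (G H : Graph) (girthG : GirthAtLeast4 G) (girthH : GirthAtLeast4 H)
  {x y z : Fin (n G)} (x-leaf : ∀ {g} → Adj G x g → g ≡ y)
  (x∼y : Adj G x y) (y∼z : Adj G y z) (z≢x : z ≢ x)
  {a b : Fin (n H)} (a∼b : Adj H a b)
  where
  open Product G H

  data Seed : Vertex → Set where
    x×b  : Seed (x , b)
    Ny×a : ∀ {g} → Adj G y g → g ≢ x → Seed (g , a)
    z×Nb : ∀ {h} → Adj H b h → h ≢ a → Seed (z , h)
    y×Na : ∀ {h} → Adj H a h → h ≢ b → Seed (y , h)

  seed? : Decidable Seed
  seed? (g , h) = map′ fromSum toSum
    (  (g ≟ x ×-dec h ≟ b)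
    ⊎-dec (T? (adj G y g) ×-dec ¬? (g ≟ x) ×-dec h ≟ a)
    ⊎-dec (g ≟ z ×-dec T? (adj H b h) ×-dec ¬? (h ≟ a))
    ⊎-dec (g ≟ y ×-dec T? (adj H a h) ×-dec ¬? (h ≟ b)))
    where
    fromSum : _ → Seed (g , h)
    fromSum (inj₁ (refl , refl))                        = x×b
    fromSum (inj₂ (inj₁ (y∼g , g≢x , refl)))            = Ny×a y∼g g≢x
    fromSum (inj₂ (inj₂ (inj₁ (refl , b∼h , h≢a))))     = z×Nb b∼h h≢a
    fromSum (inj₂ (inj₂ (inj₂ (refl , a∼h , h≢b))))     = y×Na a∼h h≢b
    toSum : Seed (g , h) → _
    toSum x×b              = inj₁ (refl , refl)
    toSum (Ny×a y∼g g≢x)   = inj₂ (inj₁ (y∼g , g≢x , refl))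
    toSum (z×Nb b∼h h≢a)   = inj₂ (inj₂ (inj₁ (refl , b∼h , h≢a)))
    toSum (y×Na a∼h h≢b)   = inj₂ (inj₂ (inj₂ (refl , a∼h , h≢b)))

  y≢x : y ≢ x
  y≢x refl = Adj-irrefl G x∼y

  a≢b : a ≢ b
  a≢b refl = Adj-irrefl H a∼b

  triangle-freeG : ∀ {c g g′} → Adj G c g → Adj G c g′ → ¬ Adj G g g′
  triangle-freeG = girth≥4⇒neighbours-nonadjacent G girthG

  triangle-freeH : ∀ {c h h′} → Adj H c h → Adj H c h′ → ¬ Adj H h h′
  triangle-freeH = girth≥4⇒neighbours-nonadjacent H girthH

  -- Every case is a loop, an equation excluded by a Seed constructor, or a triangle.
  seeds-independent : ∀ {p q} → Seed p → Seed q → ¬ p ∼ q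
  seeds-independent x×b x×b = ∼-irrefl
  seeds-independent x×b (Ny×a _ g≢x) (inj₁ (x≡g , _)) = g≢x (sym x≡g)
  seeds-independent x×b (Ny×a _ _) (inj₂ (b≡a , _)) = a≢b (sym b≡a)
  seeds-independent x×b (z×Nb _ _) (inj₁ (x≡z , _)) = z≢x (sym x≡z)
  seeds-independent x×b (z×Nb b∼b _) (inj₂ (refl , _)) = Adj-irrefl H b∼b
  seeds-independent x×b (y×Na _ _) (inj₁ (x≡y , _)) = y≢x (sym x≡y)
  seeds-independent x×b (y×Na _ h≢b) (inj₂ (b≡h , _)) = h≢b (sym b≡h)
  seeds-independent (Ny×a _ g≢x) x×b (inj₁ (g≡x , _)) = g≢x g≡x
  seeds-independent (Ny×a _ _) x×b (inj₂ (a≡b , _)) = a≢b a≡b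
  seeds-independent (Ny×a _ _) (Ny×a _ _) (inj₁ (_ , a∼a)) = Adj-irrefl H a∼a
  seeds-independent (Ny×a y∼g _) (Ny×a y∼g′ _) (inj₂ (_ , g∼g′)) = triangle-freeG y∼g y∼g′ g∼g′
  seeds-independent (Ny×a _ _) (z×Nb b∼h _) (inj₁ (refl , a∼h)) = triangle-freeH (Adj-sym H a∼b) b∼h a∼h
  seeds-independent (Ny×a _ _) (z×Nb _ h≢a) (inj₂ (a≡h , _)) = h≢a (sym a≡h)
  seeds-independent (Ny×a y∼y _) (y×Na _ _) (inj₁ (refl , _)) = Adj-irrefl G y∼y
  seeds-independent (Ny×a _ _) (y×Na a∼a _) (inj₂ (refl , _)) = Adj-irrefl H a∼a
  seeds-independent (z×Nb _ _) x×b (inj₁ (z≡x , _)) = z≢x z≡x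
  seeds-independent (z×Nb b∼b _) x×b (inj₂ (refl , _)) = Adj-irrefl H b∼b
  seeds-independent (z×Nb b∼h _) (Ny×a _ _) (inj₁ (refl , h∼a)) = triangle-freeH (Adj-sym H a∼b) b∼h (Adj-sym H h∼a)
  seeds-independent (z×Nb _ h≢a) (Ny×a _ _) (inj₂ (h≡a , _)) = h≢a h≡a
  seeds-independent (z×Nb b∼h _) (z×Nb b∼h′ _) (inj₁ (_ , h∼h′)) = triangle-freeH b∼h b∼h′ h∼h′
  seeds-independent (z×Nb _ _) (z×Nb _ _) (inj₂ (_ , z∼z)) = Adj-irrefl G z∼z
  seeds-independent (z×Nb _ _) (y×Na _ _) (inj₁ (refl , _)) = Adj-irrefl G y∼z
  seeds-independent (z×Nb b∼h _) (y×Na a∼h _) (inj₂ (refl , _)) = triangle-freeH a∼b a∼h b∼h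
  seeds-independent (y×Na _ _) x×b (inj₁ (y≡x , _)) = y≢x y≡x
  seeds-independent (y×Na _ h≢b) x×b (inj₂ (h≡b , _)) = h≢b h≡b
  seeds-independent (y×Na _ _) (Ny×a y∼y _) (inj₁ (refl , _)) = Adj-irrefl G y∼y
  seeds-independent (y×Na a∼a _) (Ny×a _ _) (inj₂ (refl , _)) = Adj-irrefl H a∼a
  seeds-independent (y×Na _ _) (z×Nb _ _) (inj₁ (refl , _)) = Adj-irrefl G y∼z
  seeds-independent (y×Na a∼h _) (z×Nb b∼h _) (inj₂ (refl , _)) = triangle-freeH a∼b a∼h b∼h
  seeds-independent (y×Na a∼h _) (y×Na a∼h′ _) (inj₁ (_ , h∼h′)) = triangle-freeH a∼h a∼h′ h∼h′
  seeds-independent (y×Na _ _) (y×Na _ _) (inj₂ (_ , y∼y)) = Adj-irrefl G y∼y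

  ya-dominated : ∃[ s ] Seed s × (y , a) ∼ s
  ya-dominated = (z , a) , Ny×a y∼z z≢x , inj₂ (refl , y∼z)

  xa-dominated : ∀ {q} → (x , a) ∼ q → q ≢ (x , b) → ∃[ s ] Seed s × q ∼ s
  xa-dominated {_ , h} (inj₁ (refl , a∼h)) q≢xb with h ≟ b
  ... | yes refl = contradiction refl q≢xb
  ... | no h≢b   = (y , h) , y×Na a∼h h≢b , inj₂ (refl , x∼y)
  xa-dominated (inj₂ (refl , x∼g)) _ rewrite x-leaf x∼g = ya-dominated

  yb-dominated : ∀ {q} → (y , b) ∼ q → q ≢ (x , b) → ∃[ s ] Seed s × q ∼ s
  yb-dominated {_ , h} (inj₁ (refl , b∼h)) _ with h ≟ a
  ... | yes refl = ya-dominated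
  ... | no h≢a   = (z , h) , z×Nb b∼h h≢a , inj₂ (refl , y∼z)
  yb-dominated {g , _} (inj₂ (refl , y∼g)) q≢xb with g ≟ x
  ... | yes refl = contradiction refl q≢xb
  ... | no g≢x   = (g , a) , Ny×a y∼g g≢x , inj₁ (refl , Adj-sym H a∼b)

  ¬wellCovered : ¬ WellCovered□ G H
  ¬wellCovered =
    exchange⇒¬wellCovered□ {G} {H} seed? seeds-independent x×b
      (inj₁ (refl , Adj-sym H a∼b)) (inj₂ (refl , x∼y)) xa≢yb xa≁yb
      xa-dominated yb-dominated
    where
    xa≢yb : (x , a) ≢ (y , b)
    xa≢yb refl = y≢x refl
    xa≁yb : ¬ (x , a) ∼ (y , b)
    xa≁yb (inj₁ (x≡y , _)) = y≢x (sym x≡y)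
    xa≁yb (inj₂ (a≡b , _)) = a≢b a≡b

lemma3p4 : (G H : Graph) →
    Nontrivial G → Nontrivial H →
    Connected G → Connected H →
    GirthAtLeast4 G → GirthAtLeast4 H →
    MinDegree G 1 → 3 ≤ n G →
    ¬ WellCovered□ G H
lemma3p4 G H _ nontrivialH connectedG connectedH girthG girthH (_ , x , deg-x≡1) 3≤n
  with degree≡1⇒unique-neighbour G deg-x≡1
... | y , x∼y , x-leaf
  with leaf-neighbour-has-other-neighbour G connectedG 3≤n x-leaf
... | z , y∼z , z≢x
  with nontrivial-connected⇒edge H nontrivialH connectedH
... | a , b , a∼b =
  LeafConfiguration.¬wellCovered G H girthG girthH x-leaf x∼y y∼z z≢x a∼b
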